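{- For $n\ge0$ and $0\le k,j\le n$: $b(n,0,j)=[j=0]$; $b(n,n,j)=[j=n]$; $b(n,k,0)=A(n,k)$; $b(n,k,n)=A(n,n-k)$; $b(n,k,j)=b(n,n-k,n-j)$. Moreover, for $n\ge1$ and $0\le k\le n$: $b(n,k,j)=(k+1)\,b(n-1,k,j)+(n-k)\,b(n-1,k-1,j)$ whenever $0\le j<n$, and $b(n,k,j)=k\,b(n-1,k,j-1)+(n-k+1)\,b(n-1,k-1,j-1)$ whenever $0<j\le n$.
   Context: $\mathcal{B}_n$ is the set of signed permutations of order $n$: bijections $\sigma$ of $\{ -n,\ldots,n\}$ with $\sigma(-i)=-\sigma(i)$, identified with $(0,\sigma_1,\ldots,\sigma_n)$; $\mathrm{des}(\sigma)$ is the number of $i\in\{1,\ldots,n\}$ with $\sigma_{i-1}>\sigma_i$ ($\sigma_0=0$). For $0\le j,k\le n$, $b(n,k,j)$ is the number of $\sigma\in\mathcal{B}_n$ with $\mathrm{des}(\sigma)=k$ such that for every $1\le i\le n$, $\sigma_i<0$ iff $|\sigma_i|\in\{1,\ldots,j\}$; $b(n,k,j)=0$ if $j$ or $k$ lies outside $\{0,\ldots,n\}$. $A(n,k)$ is the number of permutations $(\tau_1,\ldots,\tau_n)$ of $\{1,\ldots,n\}$ with exactly $k$ indices $i$ with $\tau_i>\tau_{i+1}$ ($A(0,0)=1$). $[p]$ is $1$ if $p$ holds, $0$ otherwise. -}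

module Defs where

open import Data.Nat as ℕ using (ℕ; zero; suc; _+_; _*_; _≤_; _≤?_)
open import Data.Integer as ℤ using (ℤ; +_; ∣_∣; 0ℤ)
open import Data.List using (List; []; _∷_; map; concatMap; length; filter; upTo)
open import Data.List.Relation.Unary.All using (All; all?)
open import Data.Product using (_×_)
open import Relation.Binary.PropositionalEquality using (_≡_)
open import Relation.Nullary using (Dec; yes; no; does)
open import Relation.Nullary.Decidable using (_×-dec_; _→-dec_)
open import Data.Bool using (if_then_else_)
import Data.List.Relation.Unary.Unique.DecPropositional as UniqueDec
open UniqueDec ℕ._≟_ using (Unique; unique?)
open import Data.List.Properties using (≡-dec)

words : {A : Set} → ℕ → List A → List (List A)
words zero    xs = [] ∷ []
words (suc m) xs = concatMap (λ x → map (x ∷_) (words m xs)) xs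

descℤ : List ℤ → ℕ
descℤ []           = 0
descℤ (x ∷ [])     = 0
descℤ (x ∷ y ∷ r)  = (if does (y ℤ.<? x) then 1 else 0) + descℤ (y ∷ r)

descℕ : List ℕ → ℕ
descℕ []           = 0
descℕ (x ∷ [])     = 0
descℕ (x ∷ y ∷ r)  = (if does (y ℕ.<? x) then 1 else 0) + descℕ (y ∷ r)

-- Signed permutations of order n, written as (σ_1, …, σ_n) ∈ ℤ^n:
-- σ extends to a bijection of {-n..n} with σ(-i) = -σ(i) exactly when
-- |σ_1|, …, |σ_n| are distinct elements of {1..n}.

InRange : ℕ → ℕ → Set
InRange n a = (1 ≤ a) × (a ≤ n)

IsSignedPerm : ℕ → List ℤ → Set
IsSignedPerm n σ = (length σ ≡ n) × Unique (map ∣_∣ σ) × All (InRange n) (map ∣_∣ σ)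

des : List ℤ → ℕ
des σ = descℤ (0ℤ ∷ σ)

SignCond : ℕ → List ℤ → Set
SignCond j σ = All (λ x → ((x ℤ.< 0ℤ) → (1 ≤ ∣ x ∣ × ∣ x ∣ ≤ j)) × ((1 ≤ ∣ x ∣ × ∣ x ∣ ≤ j) → (x ℤ.< 0ℤ))) σ

BCond : ℕ → ℕ → ℕ → List ℤ → Set
BCond n k j σ = IsSignedPerm n σ × (des σ ≡ k) × SignCond j σ

bcond? : ∀ n k j (σ : List ℤ) → Dec (BCond n k j σ)
bcond? n k j σ =
  ((length σ ℕ.≟ n) ×-dec (unique? (map ∣_∣ σ) ×-dec all? (λ a → (1 ≤? a) ×-dec (a ≤? n)) (map ∣_∣ σ)))
  ×-dec ((des σ ℕ.≟ k) ×-dec all? (λ x → ((x ℤ.<? 0ℤ) →-dec ((1 ≤? ∣ x ∣) ×-dec (∣ x ∣ ≤? j)))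
                                         ×-dec (((1 ≤? ∣ x ∣) ×-dec (∣ x ∣ ≤? j)) →-dec (x ℤ.<? 0ℤ))) σ)

symRange : ℕ → List ℤ
symRange n = map (λ i → (+ i) ℤ.- (+ n)) (upTo (suc (n + n)))

-- Every signed permutation of order n occurs exactly once in words n (symRange n).
bCount : ℕ → ℕ → ℕ → ℕ
bCount n k j = length (filter (bcond? n k j) (words n (symRange n)))

-- b(n,k,j), extended by 0 when j or k lies outside {0..n}.
b : ℕ → ℤ → ℤ → ℕ
b n (+ k) (+ j) with k ≤? n | j ≤? n
... | yes _ | yes _ = bCount n k j
... | _     | _     = 0
b n _ _ = 0

IsPerm : ℕ → List ℕ → Set
IsPerm n τ = (length τ ≡ n) × Unique τ × All (InRange n) τ

ACond : ℕ → ℕ → List ℕ → Set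
ACond n k τ = IsPerm n τ × (descℕ τ ≡ k)

acond? : ∀ n k (τ : List ℕ) → Dec (ACond n k τ)
acond? n k τ = ((length τ ℕ.≟ n) ×-dec (unique? τ ×-dec all? (λ a → (1 ≤? a) ×-dec (a ≤? n)) τ))
               ×-dec (descℕ τ ℕ.≟ k)

A : ℕ → ℕ → ℕ
A n k = length (filter (acond? n k) (words n (map suc (upTo n))))

[_≡ᵇ_] : ℕ → ℕ → ℕ
[ a ≡ᵇ c ] = if does (a ℕ.≟ c) then 1 else 0

-- A signed permutation counted by b(n,k,j) is a word σ₁ … σₙ using each letter of the chain
-- S = {-j, …, -1} ∪ {j+1, …, n} exactly once, read after σ₀ = 0, which lies above exactly j letters
-- of S; a permutation counted by A(n,k) is the case S = {1, …, n}, where 0 lies above no letter.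
-- Splitting such arrangements by their first letter gives a recursion involving only the size of
-- the chain, the rank of the letter in front and the number of descents: the letter of rank i
-- creates a descent iff i is below that rank, and once removed it lies above exactly i of the
-- remaining letters.  Hence b(n,k,j) = E(n, j, k) and A(n,k) = E(n, 0, k) for the solution E of
-- this recursion.  Raising the rank by one changes a single summand of the recursion, which yields
-- both recurrences by induction; the boundary values and the symmetry (k, j) ↦ (n-k, n-j) follow
-- from the recurrences by induction on n.
module Submission where

open import Data.Bool.Base using (Bool; true; false; if_then_else_)
open import Data.Integer.Base as ℤ using (ℤ; +_; -[1+_]; 0ℤ; 1ℤ; _-_; _⊖_; ∣_∣)
import Data.Integer.Properties as ℤ
open import Data.List.Base using (List; []; _∷_; _++_; map; concatMap; filter; length; upTo; applyUpTo; applyDownFrom)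
open import Data.List.Membership.Propositional using (_∈_)
open import Data.List.Properties
  using (length-++; filter-++; filter-accept; filter-reject; filter-all; filter-none; map-cong; map-cong-local;
         map-upTo; length-applyUpTo; applyUpTo-∷ʳ)
open import Data.List.Relation.Unary.All as All using (All; []; _∷_; all?)
import Data.List.Relation.Unary.All.Properties as All
open import Data.List.Relation.Unary.AllPairs as AllPairs using (AllPairs; []; _∷_)
import Data.List.Relation.Unary.AllPairs.Properties as AllPairs
open import Data.List.Relation.Unary.Any using (here; there)
open import Data.List.Relation.Unary.Unique.Propositional using (Unique)
import Data.List.Relation.Unary.Unique.Propositional.Properties as Unique
open import Data.Nat.Base as ℕ using (ℕ; zero; suc; _∸_; _⊓_; _≤_; _<_; _<ᵇ_; z≤n; s≤s)
import Data.Nat.Properties as ℕ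
open import Data.Nat.ListAction using (sum)
open import Data.Product.Base using (_×_; _,_; proj₁; proj₂)
open import Data.Sum.Base using (inj₁; inj₂)
open import Function.Base using (_∘_; id)
open import Function.Bundles using (_⇔_; mk⇔; Equivalence)
open import Level using (0ℓ)
open import Relation.Binary.Core using (Rel)
open import Relation.Binary.Definitions using (DecidableEquality)
open import Relation.Binary.PropositionalEquality
open import Relation.Binary.Structures using (IsStrictTotalOrder)
open import Relation.Nullary.Decidable using (does; yes; no; ¬?; _×-dec_; does-≡; does-⇔; dec-false)
open import Relation.Nullary.Negation using (¬_; contradiction)
open import Relation.Unary using (Pred; Decidable; _⊆_; ∁)
open import Relation.Unary.Properties using (_∩?_)
open import Defs

module Sums where

  open import Data.Nat.Base using (_+_)
  open import Data.Nat.Tactic.RingSolver using (solve-∀)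

  ∑< : ℕ → (ℕ → ℕ) → ℕ
  ∑< zero    f = 0
  ∑< (suc n) f = f 0 + ∑< n (λ i → f (suc i))

  ∑<-snoc : ∀ n f → ∑< (suc n) f ≡ ∑< n f + f n
  ∑<-snoc zero    f = ℕ.+-identityʳ (f 0)
  ∑<-snoc (suc n) f = trans (cong (λ t → f 0 + t) (∑<-snoc n (λ i → f (suc i)))) (sym (ℕ.+-assoc (f 0) _ _))

  ∑<-zero : ∀ n {f} → (∀ i → f i ≡ 0) → ∑< n f ≡ 0
  ∑<-zero zero    f≡0 = refl
  ∑<-zero (suc n) f≡0 = cong₂ _+_ (f≡0 0) (∑<-zero n (λ i → f≡0 (suc i)))

  ∑<-threshold-suc : ∀ (F : ℕ → Bool → ℕ) n r → r < n →
                     ∑< n (λ i → F i (i <ᵇ r)) + F r true ≡ ∑< n (λ i → F i (i <ᵇ suc r)) + F r false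
  ∑<-threshold-suc F (suc n) zero    _         = swap (F 0 false) (F 0 true) _
    where
    swap : ∀ a b s → a + s + b ≡ b + s + a
    swap = solve-∀
  ∑<-threshold-suc F (suc n) (suc r) (s≤s r<n) =
    trans (ℕ.+-assoc (F 0 true) _ _)
      (trans (cong (λ t → F 0 true + t) (∑<-threshold-suc (λ i → F (suc i)) n r r<n))
             (sym (ℕ.+-assoc (F 0 true) _ _)))

  ∑<-threshold-≥ : ∀ (F : ℕ → Bool → ℕ) n r → n ≤ r →
                   ∑< n (λ i → F i (i <ᵇ r)) ≡ ∑< n (λ i → F i true)
  ∑<-threshold-≥ F zero    r       _         = refl
  ∑<-threshold-≥ F (suc n) (suc r) (s≤s n≤r) =
    cong (λ t → F 0 true + t) (∑<-threshold-≥ (λ i → F (suc i)) n r n≤r)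

open Sums

module Recurrences where

  open import Data.Integer.Base using (_+_; _*_)
  open import Data.Integer.Tactic.RingSolver using (solve-∀)
  open ≡-Reasoning

  -- E m r k counts the arrangements of an m-element chain, read after a letter lying above
  -- exactly r of its elements, with k descents.
  E : ℕ → ℕ → ℤ → ℕ
  E zero    r (+ zero) = 1
  E zero    r _        = 0
  E (suc m) r k        = ∑< (suc m) (λ i → E m i (if i <ᵇ r then k - 1ℤ else k))

  Eᶻ : ℕ → ℕ → ℤ → ℤ
  Eᶻ m r k = + E m r k

  E-negative : ∀ m r n → E m r -[1+ n ] ≡ 0
  E-negative zero    r n = refl
  E-negative (suc m) r n = ∑<-zero (suc m) summand
    where
    summand : ∀ i → E m i (if i <ᵇ r then -[1+ n ] - 1ℤ else -[1+ n ]) ≡ 0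
    summand i with i <ᵇ r
    ... | true  = E-negative m i _
    ... | false = E-negative m i n

  E-raise-rank : ∀ {m r} → r ≤ m → ∀ k → Eᶻ (suc m) (suc r) k ≡ Eᶻ (suc m) r k + Eᶻ m r (k - 1ℤ) - Eᶻ m r k
  E-raise-rank {m} {r} r≤m k = begin
    Eᶻ (suc m) (suc r) k                         ≡⟨ cancel (Eᶻ (suc m) (suc r) k) (Eᶻ m r k) ⟩
    Eᶻ (suc m) (suc r) k + Eᶻ m r k - Eᶻ m r k   ≡⟨ cong (_- Eᶻ m r k) exchange ⟨
    Eᶻ (suc m) r k + Eᶻ m r (k - 1ℤ) - Eᶻ m r k  ∎
    where
    cancel : ∀ x a → x ≡ x + a - a
    cancel = solve-∀
    exchange : Eᶻ (suc m) r k + Eᶻ m r (k - 1ℤ) ≡ Eᶻ (suc m) (suc r) k + Eᶻ m r k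
    exchange = trans (sym (ℤ.pos-+ (E (suc m) r k) (E m r (k - 1ℤ))))
      (trans (cong +_ (∑<-threshold-suc (λ i b → E m i (if b then k - 1ℤ else k)) (suc m) r (s≤s r≤m)))
             (ℤ.pos-+ (E (suc m) (suc r) k) (E m r k)))

  E-top-rank : ∀ m k → E (suc m) (suc m) k ≡ ∑< (suc m) (λ i → E m i (k - 1ℤ))
  E-top-rank m k = ∑<-threshold-≥ (λ i b → E m i (if b then k - 1ℤ else k)) (suc m) (suc m) ℕ.≤-refl

  +∑<-linear : ∀ n {f g h : ℕ → ℕ} a b → (∀ {i} → i < n → + f i ≡ a * + g i + b * + h i) →
               + ∑< n f ≡ a * + ∑< n g + b * + ∑< n h
  +∑<-linear zero    a b _  = sym (cong₂ _+_ (ℤ.*-zeroʳ a) (ℤ.*-zeroʳ b))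
  +∑<-linear (suc n) {f} {g} {h} a b f≡ = begin
    + (f 0 ℕ.+ ∑< n (λ i → f (suc i)))
      ≡⟨ ℤ.pos-+ (f 0) _ ⟩
    + f 0 + + ∑< n (λ i → f (suc i))
      ≡⟨ cong₂ _+_ (f≡ (s≤s z≤n)) (+∑<-linear n a b (f≡ ∘ s≤s)) ⟩
    (a * + g 0 + b * + h 0) + (a * + ∑< n (λ i → g (suc i)) + b * + ∑< n (λ i → h (suc i)))
      ≡⟨ regroup a b _ _ _ _ ⟩
    a * (+ g 0 + + ∑< n (λ i → g (suc i))) + b * (+ h 0 + + ∑< n (λ i → h (suc i)))
      ≡⟨ cong₂ (λ x y → a * x + b * y) (ℤ.pos-+ (g 0) _) (ℤ.pos-+ (h 0) _) ⟨
    a * + ∑< (suc n) g + b * + ∑< (suc n) h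
      ∎
    where
    regroup : ∀ a b x y z w → (a * x + b * y) + (a * z + b * w) ≡ a * (x + z) + b * (y + w)
    regroup = solve-∀

  private
    vanishing-combination : ∀ x y → x * 0ℤ + y * 0ℤ ≡ 0ℤ
    vanishing-combination = solve-∀

  -- E-rec₂ at (m, r) is E-rec₁ at (m, r) plus E-raise-rank; E-rec₁ at (m + 1, r + 1) then
  -- follows from E-rec₂ at (m + 1, r) and at (m, r).
  mutual
    E-rec₁ : ∀ m r → r ≤ m → ∀ k →
             Eᶻ (suc m) r k ≡ (k + 1ℤ) * Eᶻ m r k + (+ suc m - k) * Eᶻ m r (k - 1ℤ)
    E-rec₁ zero    zero    z≤n       (+ zero)          = refl
    E-rec₁ zero    zero    z≤n       (+ suc zero)      = refl
    E-rec₁ zero    zero    z≤n       k@(+ suc (suc n)) = sym (vanishing-combination (k + 1ℤ) (+ 1 - k))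
    E-rec₁ zero    zero    z≤n       k@(-[1+ n ])      = sym (vanishing-combination (k + 1ℤ) (+ 1 - k))
    E-rec₁ (suc m) zero    z≤n       k = begin
      Eᶻ (suc (suc m)) 0 k
        ≡⟨ cong +_ (∑<-snoc (suc m) (λ i → E (suc m) i k)) ⟩
      + (∑< (suc m) (λ i → E (suc m) i k) ℕ.+ E (suc m) (suc m) k)
        ≡⟨ ℤ.pos-+ (∑< (suc m) (λ i → E (suc m) i k)) _ ⟩
      + ∑< (suc m) (λ i → E (suc m) i k) + Eᶻ (suc m) (suc m) k
        ≡⟨ cong₂ _+_ (+∑<-linear (suc m) (k + 1ℤ) (+ suc m - k) (λ i≤m → E-rec₁ m _ (ℕ.≤-pred i≤m) k))
                     (cong +_ (E-top-rank m k)) ⟩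
      (k + 1ℤ) * Eᶻ (suc m) 0 k + (+ suc m - k) * Eᶻ (suc m) 0 (k - 1ℤ) + Eᶻ (suc m) 0 (k - 1ℤ)
        ≡⟨ absorb k (+ suc m) _ _ ⟩
      (k + 1ℤ) * Eᶻ (suc m) 0 k + (+ suc (suc m) - k) * Eᶻ (suc m) 0 (k - 1ℤ)
        ∎
      where
      absorb : ∀ k M a b → (k + 1ℤ) * a + (M - k) * b + b ≡ (k + 1ℤ) * a + (1ℤ + M - k) * b
      absorb = solve-∀
    E-rec₁ (suc m) (suc r) (s≤s r≤m) k = begin
      Eᶻ (suc (suc m)) (suc r) k
        ≡⟨ E-rec₂ (suc m) r (ℕ.m≤n⇒m≤1+n r≤m) k ⟩
      k * Eᶻ (suc m) r k + (+ suc (suc m) - k + 1ℤ) * Eᶻ (suc m) r (k - 1ℤ)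
        ≡⟨ cong₂ (λ x y → k * x + (+ suc (suc m) - k + 1ℤ) * y)
                 (E-rec₁ m r r≤m k) (E-rec₁ m r r≤m (k - 1ℤ)) ⟩
      k * ((k + 1ℤ) * e₀ + (+ suc m - k) * e₁)
        + (+ suc (suc m) - k + 1ℤ) * ((k - 1ℤ + 1ℤ) * e₁ + (+ suc m - (k - 1ℤ)) * e₂)
        ≡⟨ exchange k (+ suc m) e₀ e₁ e₂ ⟩
      (k + 1ℤ) * (k * e₀ + (+ suc m - k + 1ℤ) * e₁)
        + (+ suc (suc m) - k) * ((k - 1ℤ) * e₁ + (+ suc m - (k - 1ℤ) + 1ℤ) * e₂)
        ≡⟨ cong₂ (λ x y → (k + 1ℤ) * x + (+ suc (suc m) - k) * y)
                 (E-rec₂ m r r≤m k) (E-rec₂ m r r≤m (k - 1ℤ)) ⟨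
      (k + 1ℤ) * Eᶻ (suc m) (suc r) k + (+ suc (suc m) - k) * Eᶻ (suc m) (suc r) (k - 1ℤ)
        ∎
      where
      e₀ = Eᶻ m r k
      e₁ = Eᶻ m r (k - 1ℤ)
      e₂ = Eᶻ m r (k - 1ℤ - 1ℤ)
      exchange : ∀ k M a b c →
        k * ((k + 1ℤ) * a + (M - k) * b) + (1ℤ + M - k + 1ℤ) * ((k - 1ℤ + 1ℤ) * b + (M - (k - 1ℤ)) * c)
          ≡ (k + 1ℤ) * (k * a + (M - k + 1ℤ) * b) + (1ℤ + M - k) * ((k - 1ℤ) * b + (M - (k - 1ℤ) + 1ℤ) * c)
      exchange = solve-∀

    E-rec₂ : ∀ m r → r ≤ m → ∀ k →
             Eᶻ (suc m) (suc r) k ≡ k * Eᶻ m r k + (+ suc m - k + 1ℤ) * Eᶻ m r (k - 1ℤ)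
    E-rec₂ m r r≤m k = begin
      Eᶻ (suc m) (suc r) k
        ≡⟨ E-raise-rank r≤m k ⟩
      Eᶻ (suc m) r k + Eᶻ m r (k - 1ℤ) - Eᶻ m r k
        ≡⟨ cong (λ x → x + Eᶻ m r (k - 1ℤ) - Eᶻ m r k) (E-rec₁ m r r≤m k) ⟩
      (k + 1ℤ) * Eᶻ m r k + (+ suc m - k) * Eᶻ m r (k - 1ℤ) + Eᶻ m r (k - 1ℤ) - Eᶻ m r k
        ≡⟨ lower k (+ suc m) _ _ ⟩
      k * Eᶻ m r k + (+ suc m - k + 1ℤ) * Eᶻ m r (k - 1ℤ)
        ∎
      where
      lower : ∀ k M a b → (k + 1ℤ) * a + (M - k) * b + b - a ≡ k * a + (M - k + 1ℤ) * b
      lower = solve-∀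

  -- Reflecting (r, k) to (m - r, m - k) exchanges the two recurrences.
  E-sym-step : ∀ {m} → (∀ r → r ≤ m → ∀ k → E m r k ≡ E m (m ∸ r) (+ m - k)) →
               ∀ {r} → r ≤ m → ∀ k → Eᶻ (suc m) r k ≡ Eᶻ (suc m) (suc (m ∸ r)) (+ suc m - k)
  E-sym-step {m} E-sym-m {r} r≤m k = begin
    Eᶻ (suc m) r k
      ≡⟨ E-rec₁ m r r≤m k ⟩
    (k + 1ℤ) * Eᶻ m r k + (+ suc m - k) * Eᶻ m r (k - 1ℤ)
      ≡⟨ cong₂ (λ x y → (k + 1ℤ) * + x + (+ suc m - k) * + y) (E-sym-m r r≤m k) (E-sym-m r r≤m (k - 1ℤ)) ⟩
    (k + 1ℤ) * Eᶻ m r′ (+ m - k) + (+ suc m - k) * Eᶻ m r′ (+ m - (k - 1ℤ))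
      ≡⟨ cong₂ (λ x y → (k + 1ℤ) * Eᶻ m r′ x + (+ suc m - k) * Eᶻ m r′ y) (down k (+ m)) (up k (+ m)) ⟩
    (k + 1ℤ) * Eᶻ m r′ (+ suc m - k - 1ℤ) + (+ suc m - k) * Eᶻ m r′ (+ suc m - k)
      ≡⟨ swap k (+ suc m) _ _ ⟩
    (+ suc m - k) * Eᶻ m r′ (+ suc m - k) + (+ suc m - (+ suc m - k) + 1ℤ) * Eᶻ m r′ (+ suc m - k - 1ℤ)
      ≡⟨ E-rec₂ m r′ (ℕ.m∸n≤m m r) (+ suc m - k) ⟨
    Eᶻ (suc m) (suc r′) (+ suc m - k)
      ∎
    where
    r′ = m ∸ r
    down : ∀ k M → M - k ≡ 1ℤ + M - k - 1ℤ
    down = solve-∀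
    up : ∀ k M → M - (k - 1ℤ) ≡ 1ℤ + M - k
    up = solve-∀
    swap : ∀ k M a b → (k + 1ℤ) * a + (M - k) * b ≡ (M - k) * b + (M - (M - k) + 1ℤ) * a
    swap = solve-∀

  E-sym : ∀ m r → r ≤ m → ∀ k → E m r k ≡ E m (m ∸ r) (+ m - k)
  E-sym zero    zero z≤n (+ zero)  = refl
  E-sym zero    zero z≤n (+ suc n) = refl
  E-sym zero    zero z≤n -[1+ n ]  = refl
  E-sym (suc m) r r≤1+m k with ℕ.m≤n⇒m<n∨m≡n r≤1+m
  ... | inj₁ (s≤s r≤m) = ℤ.+-injective (begin
    Eᶻ (suc m) r k                          ≡⟨ E-sym-step (E-sym m) r≤m k ⟩
    Eᶻ (suc m) (suc (m ∸ r)) (+ suc m - k)  ≡⟨ cong (λ r′ → Eᶻ (suc m) r′ (+ suc m - k)) (ℕ.+-∸-assoc 1 r≤m) ⟨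
    Eᶻ (suc m) (suc m ∸ r) (+ suc m - k)    ∎)
  ... | inj₂ refl = ℤ.+-injective (begin
    Eᶻ (suc m) (suc m) k                          ≡⟨ cong (Eᶻ (suc m) (suc m)) (involutive k (+ suc m)) ⟩
    Eᶻ (suc m) (suc m) (+ suc m - (+ suc m - k))  ≡⟨ E-sym-step (E-sym m) z≤n (+ suc m - k) ⟨
    Eᶻ (suc m) 0 (+ suc m - k)                    ≡⟨ cong (λ r′ → Eᶻ (suc m) r′ (+ suc m - k)) (ℕ.n∸n≡0 m) ⟨
    Eᶻ (suc m) (m ∸ m) (+ suc m - k)              ∎)
    where
    involutive : ∀ k M → k ≡ M - (M - k)
    involutive = solve-∀

  E-above : ∀ {m r k} → r ≤ m → m < k → E m r (+ k) ≡ 0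
  E-above {m} {r} {suc k} r≤m (s≤s m≤k) = begin
    E m r (+ suc k)                ≡⟨ E-sym m r r≤m (+ suc k) ⟩
    E m (m ∸ r) (+ m - + suc k)    ≡⟨ cong (E m (m ∸ r)) negative ⟩
    E m (m ∸ r) -[1+ k ∸ m ]       ≡⟨ E-negative m (m ∸ r) (k ∸ m) ⟩
    0                              ∎
    where
    negative : + m - + suc k ≡ -[1+ k ∸ m ]
    negative = trans (ℤ.m-n≡m⊖n m (suc k))
                     (trans (ℤ.⊖-< (s≤s m≤k)) (cong (λ t → ℤ.- (+ t)) (ℕ.+-∸-assoc 1 m≤k)))

  E-no-descent : ∀ m r → r ≤ m → E m r 0ℤ ≡ [ r ≡ᵇ 0 ]
  E-no-descent zero    zero z≤n = refl
  E-no-descent (suc m) r r≤1+m with ℕ.m≤n⇒m<n∨m≡n r≤1+m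
  ... | inj₁ (s≤s r≤m) = ℤ.+-injective (begin
    Eᶻ (suc m) r 0ℤ
      ≡⟨ E-rec₁ m r r≤m 0ℤ ⟩
    1ℤ * Eᶻ m r 0ℤ + (+ suc m - 0ℤ) * Eᶻ m r -[1+ 0 ]
      ≡⟨ cong (λ x → 1ℤ * Eᶻ m r 0ℤ + (+ suc m - 0ℤ) * + x) (E-negative m r 0) ⟩
    1ℤ * Eᶻ m r 0ℤ + (+ suc m - 0ℤ) * 0ℤ
      ≡⟨ drop (Eᶻ m r 0ℤ) (+ suc m - 0ℤ) ⟩
    Eᶻ m r 0ℤ
      ≡⟨ cong +_ (E-no-descent m r r≤m) ⟩
    + [ r ≡ᵇ 0 ]
      ∎)
    where
    drop : ∀ a c → 1ℤ * a + c * 0ℤ ≡ a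
    drop = solve-∀
  ... | inj₂ refl = ℤ.+-injective (begin
    Eᶻ (suc m) (suc m) 0ℤ
      ≡⟨ E-rec₂ m m ℕ.≤-refl 0ℤ ⟩
    0ℤ * Eᶻ m m 0ℤ + (+ suc m - 0ℤ + 1ℤ) * Eᶻ m m -[1+ 0 ]
      ≡⟨ cong (λ x → 0ℤ * Eᶻ m m 0ℤ + (+ suc m - 0ℤ + 1ℤ) * + x) (E-negative m m 0) ⟩
    0ℤ * Eᶻ m m 0ℤ + (+ suc m - 0ℤ + 1ℤ) * 0ℤ
      ≡⟨ vanish (Eᶻ m m 0ℤ) (+ suc m - 0ℤ + 1ℤ) ⟩
    0ℤ
      ∎)
    where
    vanish : ∀ a c → 0ℤ * a + c * 0ℤ ≡ 0ℤ
    vanish = solve-∀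

  E-all-descents : ∀ m r → r ≤ m → E m r (+ m) ≡ [ r ≡ᵇ m ]
  E-all-descents m r r≤m = begin
    E m r (+ m)                ≡⟨ E-sym m r r≤m (+ m) ⟩
    E m (m ∸ r) (+ m - + m)    ≡⟨ cong (E m (m ∸ r)) (ℤ.+-inverseʳ (+ m)) ⟩
    E m (m ∸ r) 0ℤ             ≡⟨ E-no-descent m (m ∸ r) (ℕ.m∸n≤m m r) ⟩
    [ m ∸ r ≡ᵇ 0 ]             ≡⟨ cong (λ t → if t then 1 else 0) (does-⇔ m∸r≡0⇔r≡m (m ∸ r ℕ.≟ 0) (r ℕ.≟ m)) ⟩
    [ r ≡ᵇ m ]                 ∎
    where
    m∸r≡0⇔r≡m : (m ∸ r ≡ 0) ⇔ (r ≡ m)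
    m∸r≡0⇔r≡m = mk⇔ (ℕ.≤-antisym r≤m ∘ ℕ.m∸n≡0⇒m≤n) (λ { refl → ℕ.n∸n≡0 m })

  +suc≡⇔≡-1 : ∀ d k → (+ suc d ≡ k) ⇔ (+ d ≡ k - 1ℤ)
  +suc≡⇔≡-1 d k = mk⇔ (λ { refl → refl }) λ d≡k-1 → begin
    + suc d         ≡⟨ ℤ.pos-+ 1 d ⟩
    1ℤ + + d        ≡⟨ cong (λ x → 1ℤ + x) d≡k-1 ⟩
    1ℤ + (k - 1ℤ)   ≡⟨ cancel k ⟩
    k               ∎
    where
    cancel : ∀ k → 1ℤ + (k - 1ℤ) ≡ k
    cancel = solve-∀

open Recurrences

open import Data.Nat using (_+_; _*_)

count : {A : Set} {P : Pred A 0ℓ} → Decidable P → List A → ℕ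
count P? xs = length (filter P? xs)

count-cong-∈ : {A : Set} {P Q : Pred A 0ℓ} (P? : Decidable P) (Q? : Decidable Q) (xs : List A) →
               (∀ {x} → x ∈ xs → P x ⇔ Q x) → count P? xs ≡ count Q? xs
count-cong-∈ P? Q? []       P⇔Q = refl
count-cong-∈ P? Q? (x ∷ xs) P⇔Q
  with does (P? x) | does (Q? x) | does-⇔ (P⇔Q (here refl)) (P? x) (Q? x)
... | true  | .true  | refl = cong suc (count-cong-∈ P? Q? xs (P⇔Q ∘ there))
... | false | .false | refl = count-cong-∈ P? Q? xs (P⇔Q ∘ there)

count-none : {A : Set} {P : Pred A 0ℓ} {xs : List A} (P? : Decidable P) → All (∁ P) xs → count P? xs ≡ 0
count-none P? ¬Pxs = cong length (filter-none P? ¬Pxs)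

count-map : {A B : Set} {P : Pred B 0ℓ} (P? : Decidable P) (f : A → B) (xs : List A) →
            count P? (map f xs) ≡ count (P? ∘ f) xs
count-map P? f []       = refl
count-map P? f (x ∷ xs) with does (P? (f x))
... | true  = cong suc (count-map P? f xs)
... | false = count-map P? f xs

count-++ : {A : Set} {P : Pred A 0ℓ} (P? : Decidable P) (xs ys : List A) →
           count P? (xs ++ ys) ≡ count P? xs + count P? ys
count-++ P? xs ys = trans (cong length (filter-++ P? xs ys)) (length-++ (filter P? xs))

count-concatMap : {A B : Set} {P : Pred B 0ℓ} (P? : Decidable P) (f : A → List B) (xs : List A) →
                  count P? (concatMap f xs) ≡ sum (map (count P? ∘ f) xs)
count-concatMap P? f []       = refl
count-concatMap P? f (x ∷ xs) =
  trans (count-++ P? (f x) (concatMap f xs)) (cong (λ t → count P? (f x) + t) (count-concatMap P? f xs))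

count-filter-⊆ : {A : Set} {P Q : Pred A 0ℓ} (P? : Decidable P) (Q? : Decidable Q) → P ⊆ Q →
                 (xs : List A) → count P? (filter Q? xs) ≡ count P? xs
count-filter-⊆ P? Q? P⊆Q [] = refl
count-filter-⊆ P? Q? P⊆Q (x ∷ xs) with Q? x
... | no ¬Qx = trans (count-filter-⊆ P? Q? P⊆Q xs) (sym (cong length (filter-reject P? (¬Qx ∘ P⊆Q))))
... | yes _ with does (P? x)
...   | true  = cong suc (count-filter-⊆ P? Q? P⊆Q xs)
...   | false = count-filter-⊆ P? Q? P⊆Q xs

count-≢ : {A : Set} (_≟_ : DecidableEquality A) {x : A} {xs : List A} → Unique xs → x ∈ xs →
          suc (count (λ y → ¬? (x ≟ y)) xs) ≡ length xs
count-≢ _≟_ {xs = x ∷ xs} (x∉xs ∷ _) (here refl) =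
  cong suc (trans (cong length (filter-reject (λ y → ¬? (x ≟ y)) (λ x≢x → x≢x refl)))
                  (cong length (filter-all (λ y → ¬? (x ≟ y)) x∉xs)))
count-≢ _≟_ {x} {y ∷ xs} (y∉xs ∷ xs!) (there x∈xs) =
  cong suc (trans (cong length (filter-accept (λ z → ¬? (x ≟ z)) (λ x≡y → All.lookup y∉xs x∈xs (sym x≡y))))
                  (count-≢ _≟_ xs! x∈xs))

sum-map-filter : {A : Set} {P : Pred A 0ℓ} (P? : Decidable P) {g h : A → ℕ} →
                 (∀ {x} → P x → h x ≡ g x) → (∀ {x} → ¬ P x → h x ≡ 0) →
                 (xs : List A) → sum (map h xs) ≡ sum (map g (filter P? xs))
sum-map-filter P? h≡g h≡0 [] = refl
sum-map-filter P? {h = h} h≡g h≡0 (x ∷ xs) with P? x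
... | yes Px = cong₂ _+_ (h≡g Px) (sum-map-filter P? h≡g h≡0 xs)
... | no ¬Px = trans (cong (_+ sum (map h xs)) (h≡0 ¬Px)) (sum-map-filter P? h≡g h≡0 xs)

applyUpTo-cong : {A : Set} {f g : ℕ → A} (n : ℕ) → (∀ i → f i ≡ g i) → applyUpTo f n ≡ applyUpTo g n
applyUpTo-cong zero    f≗g = refl
applyUpTo-cong (suc n) f≗g = cong₂ _∷_ (f≗g 0) (applyUpTo-cong n (f≗g ∘ suc))

applyUpTo-++ : {A : Set} (f : ℕ → A) (m n : ℕ) →
               applyUpTo f (m + n) ≡ applyUpTo f m ++ applyUpTo (λ i → f (m + i)) n
applyUpTo-++ f zero    n = refl
applyUpTo-++ f (suc m) n = cong (f 0 ∷_) (applyUpTo-++ (f ∘ suc) m n)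

words-length : {A : Set} (m : ℕ) (L : List A) → All (λ w → length w ≡ m) (words m L)
words-length zero    L = refl ∷ []
words-length (suc m) L = concatMap⁺ L
  where
  concatMap⁺ : ∀ xs → All (λ w → length w ≡ suc m) (concatMap (λ x → map (x ∷_) (words m L)) xs)
  concatMap⁺ []       = []
  concatMap⁺ (x ∷ xs) = All.++⁺ (All.map⁺ (All.map (cong suc) (words-length m L))) (concatMap⁺ xs)

count-words-filter : {A : Set} {P : Pred A 0ℓ} {Q : Pred (List A) 0ℓ} (P? : Decidable P) (Q? : Decidable Q) →
                     ∀ m (L : List A) → count (all? P? ∩? Q?) (words m L) ≡ count Q? (words m (filter P? L))
count-words-filter P? Q? zero L = count-cong-∈ (all? P? ∩? Q?) Q? ([] ∷ []) λ { (here refl) → mk⇔ proj₂ ([] ,_) }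
count-words-filter {P = P} P? Q? (suc m) L = begin
  count R? (concatMap (λ x → map (x ∷_) (words m L)) L)   ≡⟨ count-concatMap R? _ L ⟩
  sum (map (λ x → count R? (map (x ∷_) (words m L))) L)   ≡⟨ sum-map-filter P? first-allowed first-forbidden L ⟩
  sum (map (λ x → count Q? (map (x ∷_) (words m L′))) L′) ≡⟨ count-concatMap Q? _ L′ ⟨
  count Q? (words (suc m) L′)                             ∎
  where
  open ≡-Reasoning
  R? = all? P? ∩? Q?
  L′ = filter P? L
  first-allowed : ∀ {x} → P x → count R? (map (x ∷_) (words m L)) ≡ count Q? (map (x ∷_) (words m L′))
  first-allowed {x} Px = begin
    count R? (map (x ∷_) (words m L))
      ≡⟨ count-map R? (x ∷_) (words m L) ⟩
    count (R? ∘ (x ∷_)) (words m L)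
      ≡⟨ count-cong-∈ (R? ∘ (x ∷_)) (all? P? ∩? (Q? ∘ (x ∷_))) (words m L)
                      (λ _ → mk⇔ (λ { (_ ∷ Pw , Qxw) → Pw , Qxw }) (λ { (Pw , Qxw) → Px ∷ Pw , Qxw })) ⟩
    count (all? P? ∩? (Q? ∘ (x ∷_))) (words m L)
      ≡⟨ count-words-filter P? (Q? ∘ (x ∷_)) m L ⟩
    count (Q? ∘ (x ∷_)) (words m L′)
      ≡⟨ count-map Q? (x ∷_) (words m L′) ⟨
    count Q? (map (x ∷_) (words m L′))
      ∎
  first-forbidden : ∀ {x} → ¬ P x → count R? (map (x ∷_) (words m L)) ≡ 0
  first-forbidden ¬Px = count-none R? (All.map⁺ (All.universal (λ { _ (Px ∷ _ , _) → ¬Px Px }) (words m L)))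

module Arrangements {X : Set} {_<_ : Rel X 0ℓ} (<-isStrictTotalOrder : IsStrictTotalOrder _≡_ _<_) where

  open IsStrictTotalOrder <-isStrictTotalOrder public using (_<?_)
  open IsStrictTotalOrder <-isStrictTotalOrder using (_≟_; irrefl; asym) renaming (trans to <-trans)
  open import Data.List.Relation.Unary.Unique.DecPropositional _≟_ using (unique?)
  open ≡-Reasoning

  descents : List X → ℕ
  descents []          = 0
  descents (x ∷ [])    = 0
  descents (x ∷ y ∷ w) = (if does (y <? x) then 1 else 0) + descents (y ∷ w)

  Arrangement : X → ℤ → Pred (List X) 0ℓ
  Arrangement f k w = Unique w × + descents (f ∷ w) ≡ k

  arrangement? : ∀ f k → Decidable (Arrangement f k)
  arrangement? f k w = unique? w ×-dec (+ descents (f ∷ w) ℤ.≟ k)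

  rank : List X → X → ℕ
  rank S x = count (_<? x) S

  rank-head : ∀ {s S} → All (s <_) S → rank (s ∷ S) s ≡ 0
  rank-head s<S = count-none (_<? _) (irrefl refl ∷ All.map asym s<S)

  rank-above : ∀ {s S x} → s < x → rank (s ∷ S) x ≡ suc (rank S x)
  rank-above {x = x} s<x = cong length (filter-accept (_<? x) s<x)

  rank-below : ∀ {s S x} → All (s <_) S → ¬ s < x → rank S x ≡ 0
  rank-below s<S s≮x = count-none (_<? _) (All.map (λ s<y y<x → s≮x (<-trans s<y y<x)) s<S)

  ∑<-rank-∷ : ∀ {s S} f (F : ℕ → Bool → ℕ) → All (s <_) S →
              F 0 (does (s <? f)) + ∑< (length S) (λ i → F (suc i) (i <ᵇ rank S f))
                ≡ ∑< (suc (length S)) (λ i → F i (i <ᵇ rank (s ∷ S) f))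
  ∑<-rank-∷ {s} f F s<S with s <? f
  ... | yes _   = refl
  ... | no  s≮f rewrite rank-below s<S s≮f = refl

  -- In an increasing list the ranks of the letters are 0, 1, 2, …, and x < f iff rank x < rank f.
  sum-by-rank : ∀ {S} → AllPairs _<_ S → ∀ f (F : ℕ → Bool → ℕ) →
                sum (map (λ x → F (rank S x) (does (x <? f))) S) ≡ ∑< (length S) (λ i → F i (i <ᵇ rank S f))
  sum-by-rank []                 f F = refl
  sum-by-rank {s ∷ S} (s<S ∷ S↑) f F = begin
    F (rank (s ∷ S) s) (does (s <? f)) + sum (map (λ x → F (rank (s ∷ S) x) (does (x <? f))) S)
      ≡⟨ cong₂ _+_ (cong (λ r → F r (does (s <? f))) (rank-head s<S))
                   (cong sum (map-cong-local (All.map (λ {x} s<x → cong (λ r → F r (does (x <? f))) (rank-above s<x))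
                                                       s<S))) ⟩
    F 0 (does (s <? f)) + sum (map (λ x → F (suc (rank S x)) (does (x <? f))) S)
      ≡⟨ cong (λ t → F 0 (does (s <? f)) + t) (sum-by-rank S↑ f (F ∘ suc)) ⟩
    F 0 (does (s <? f)) + ∑< (length S) (λ i → F (suc i) (i <ᵇ rank S f))
      ≡⟨ ∑<-rank-∷ f F s<S ⟩
    ∑< (suc (length S)) (λ i → F i (i <ᵇ rank (s ∷ S) f))
      ∎

  descents-∷ : ∀ f x w k →
               (+ descents (f ∷ x ∷ w) ≡ k) ⇔ (+ descents (x ∷ w) ≡ (if does (x <? f) then k - 1ℤ else k))
  descents-∷ f x w k with does (x <? f)
  ... | true  = +suc≡⇔≡-1 (descents (x ∷ w)) k
  ... | false = mk⇔ id id

  Arrangement-∷ : ∀ {f k x w} → Arrangement f k (x ∷ w) ⇔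
                  (All (λ y → ¬ x ≡ y) w × Arrangement x (if does (x <? f) then k - 1ℤ else k) w)
  Arrangement-∷ {f} {k} {x} {w} = mk⇔
    (λ { (x∉w ∷ w! , d≡k) → x∉w , w! , Equivalence.to (descents-∷ f x w k) d≡k })
    (λ { (x∉w , w! , d≡k) → (x∉w ∷ w!) , Equivalence.from (descents-∷ f x w k) d≡k })

  count-arrangements : ∀ m S → length S ≡ m → AllPairs _<_ S → ∀ f k →
                       count (arrangement? f k) (words m S) ≡ E m (rank S f) k
  count-arrangements zero    [] _ _ f (+ zero)  = refl
  count-arrangements zero    [] _ _ f (+ suc n) = refl
  count-arrangements zero    [] _ _ f -[1+ n ]  = refl
  count-arrangements (suc m) S |S|≡1+m S↑ f k = begin
    count (arrangement? f k) (words (suc m) S)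
      ≡⟨ count-concatMap (arrangement? f k) (λ x → map (x ∷_) (words m S)) S ⟩
    sum (map (λ x → count (arrangement? f k) (map (x ∷_) (words m S))) S)
      ≡⟨ cong sum (map-cong-local (All.tabulate starting-with)) ⟩
    sum (map (λ x → E m (rank S x) (if does (x <? f) then k - 1ℤ else k)) S)
      ≡⟨ sum-by-rank S↑ f (λ i b → E m i (if b then k - 1ℤ else k)) ⟩
    ∑< (length S) (λ i → E m i (if i <ᵇ rank S f then k - 1ℤ else k))
      ≡⟨ cong (λ n → ∑< n (λ i → E m i (if i <ᵇ rank S f then k - 1ℤ else k))) |S|≡1+m ⟩
    E (suc m) (rank S f) k
      ∎
    where
    S! : Unique S
    S! = AllPairs.map (λ x<y x≡y → irrefl x≡y x<y) S↑
    starting-with : ∀ {x} → x ∈ S → count (arrangement? f k) (map (x ∷_) (words m S))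
                                      ≡ E m (rank S x) (if does (x <? f) then k - 1ℤ else k)
    starting-with {x} x∈S = begin
      count (arrangement? f k) (map (x ∷_) (words m S))
        ≡⟨ count-map (arrangement? f k) (x ∷_) (words m S) ⟩
      count (arrangement? f k ∘ (x ∷_)) (words m S)
        ≡⟨ count-cong-∈ (arrangement? f k ∘ (x ∷_)) (all? x≢? ∩? arrangement? x k′) (words m S)
                        (λ _ → Arrangement-∷) ⟩
      count (all? x≢? ∩? arrangement? x k′) (words m S)
        ≡⟨ count-words-filter x≢? (arrangement? x k′) m S ⟩
      count (arrangement? x k′) (words m (filter x≢? S))
        ≡⟨ count-arrangements m (filter x≢? S) |S-x|≡m (AllPairs.filter⁺ x≢? S↑) x k′ ⟩
      E m (rank (filter x≢? S) x) k′
        ≡⟨ cong (λ r → E m r k′) (count-filter-⊆ (_<? x) x≢? (λ y<x x≡y → irrefl (sym x≡y) y<x) S) ⟩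
      E m (rank S x) k′
        ∎
      where
      k′ = if does (x <? f) then k - 1ℤ else k
      x≢? = λ y → ¬? (x ≟ y)
      |S-x|≡m = ℕ.suc-injective (trans (count-≢ _≟_ S! x∈S) |S|≡1+m)

module Arrℕ = Arrangements ℕ.<-isStrictTotalOrder
module Arrℤ = Arrangements ℤ.<-isStrictTotalOrder

descents≡descℕ : ∀ w → Arrℕ.descents w ≡ descℕ w
descents≡descℕ []          = refl
descents≡descℕ (x ∷ [])    = refl
descents≡descℕ (x ∷ y ∷ w) =
  cong₂ (λ b d → (if b then 1 else 0) + d) (does-≡ (y Arrℕ.<? x) (y ℕ.<? x)) (descents≡descℕ (y ∷ w))

descents≡descℤ : ∀ w → Arrℤ.descents w ≡ descℤ w
descents≡descℤ []          = refl
descents≡descℤ (x ∷ [])    = refl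
descents≡descℤ (x ∷ y ∷ w) =
  cong₂ (λ b d → (if b then 1 else 0) + d) (does-≡ (y Arrℤ.<? x) (y ℤ.<? x)) (descents≡descℤ (y ∷ w))

inRange? : ∀ n → Decidable (InRange n)
inRange? n a = (1 ℕ.≤? a) ×-dec (a ℕ.≤? n)

descents-0∷ : ∀ τ → Arrℕ.descents (0 ∷ τ) ≡ descℕ τ
descents-0∷ []      = refl
descents-0∷ (y ∷ τ) =
  trans (cong (λ b → (if b then 1 else 0) + Arrℕ.descents (y ∷ τ)) (dec-false (y Arrℕ.<? 0) λ ()))
        (descents≡descℕ (y ∷ τ))

ACond⇔ : ∀ {n k τ} → length τ ≡ n → ACond n k τ ⇔ (All (InRange n) τ × Arrℕ.Arrangement 0 (+ k) τ)
ACond⇔ {τ = τ} |τ|≡n = mk⇔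
  (λ { ((_ , τ! , τ⊆) , d≡k) → τ⊆ , τ! , cong +_ (trans (descents-0∷ τ) d≡k) })
  (λ { (τ⊆ , τ! , d≡k) → (|τ|≡n , τ! , τ⊆) , trans (sym (descents-0∷ τ)) (ℤ.+-injective d≡k) })

A≡E : ∀ n k → A n k ≡ E n 0 (+ k)
A≡E n k = begin
  count (acond? n k) (words n L)
    ≡⟨ count-cong-∈ (acond? n k) (all? (inRange? n) ∩? arrangement?) (words n L)
                    (ACond⇔ ∘ All.lookup (words-length n L)) ⟩
  count (all? (inRange? n) ∩? arrangement?) (words n L)
    ≡⟨ count-words-filter (inRange? n) arrangement? n L ⟩
  count arrangement? (words n (filter (inRange? n) L))
    ≡⟨ cong (λ S → count arrangement? (words n S)) (filter-all (inRange? n) L⊆[1,n]) ⟩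
  count arrangement? (words n L)
    ≡⟨ Arrℕ.count-arrangements n L |L|≡n L↑ 0 (+ k) ⟩
  E n (Arrℕ.rank L 0) (+ k)
    ≡⟨ cong (λ r → E n r (+ k)) (count-none (Arrℕ._<? 0) (All.universal (λ _ ()) L)) ⟩
  E n 0 (+ k)
    ∎
  where
  open ≡-Reasoning
  arrangement? = Arrℕ.arrangement? 0 (+ k)
  L = map suc (upTo n)
  L≡ : L ≡ applyUpTo suc n
  L≡ = map-upTo suc n
  L⊆[1,n] : All (InRange n) L
  L⊆[1,n] rewrite L≡ = All.applyUpTo⁺₁ suc n (λ i<n → s≤s z≤n , i<n)
  L↑ : AllPairs ℕ._<_ L
  L↑ rewrite L≡ = AllPairs.applyUpTo⁺₁ suc n (λ i<j _ → s≤s i<j)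
  |L|≡n : length L ≡ n
  |L|≡n rewrite L≡ = length-applyUpTo suc n

-- The letters of the signed permutations counted by b(n,k,j): -j, …, -1 and j+1, …, n.
Admissible : ℕ → ℕ → Pred ℤ 0ℓ
Admissible n j (+ a)    = j < a × a ≤ n
Admissible n j -[1+ a ] = a < j

admissible? : ∀ n j → Decidable (Admissible n j)
admissible? n j (+ a)    = (j ℕ.<? a) ×-dec (a ℕ.≤? n)
admissible? n j -[1+ a ] = a ℕ.<? j

SignedLetter : ℕ → ℕ → Pred ℤ 0ℓ
SignedLetter n j x =
  InRange n ∣ x ∣ × ((x ℤ.< 0ℤ → 1 ≤ ∣ x ∣ × ∣ x ∣ ≤ j) × (1 ≤ ∣ x ∣ × ∣ x ∣ ≤ j → x ℤ.< 0ℤ))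

SignedLetter⇔Admissible : ∀ {n j} → j ≤ n → ∀ x → SignedLetter n j x ⇔ Admissible n j x
SignedLetter⇔Admissible j≤n (+ a) = mk⇔
  (λ { ((1≤a , a≤n) , _ , a≤j⇒+a<0) → ℕ.≰⇒> (λ a≤j → ℤ.+≮0 (a≤j⇒+a<0 (1≤a , a≤j))) , a≤n })
  (λ { (j<a , a≤n) → (ℕ.≤-trans (s≤s z≤n) j<a , a≤n)
                   , (λ +a<0 → contradiction +a<0 ℤ.+≮0) , (λ (_ , a≤j) → contradiction a≤j (ℕ.<⇒≱ j<a)) })
SignedLetter⇔Admissible j≤n -[1+ a ] = mk⇔
  (λ { (_ , negative⇒ , _) → proj₂ (negative⇒ ℤ.-<+) })
  (λ a<j → (s≤s z≤n , ℕ.≤-trans a<j j≤n) , (λ _ → s≤s z≤n , a<j) , (λ _ → ℤ.-<+))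

∣∣-injective : ∀ {n j x y} → Admissible n j x → Admissible n j y → ∣ x ∣ ≡ ∣ y ∣ → x ≡ y
∣∣-injective {x = + _}      { + _ }      _         _         refl = refl
∣∣-injective {x = -[1+ _ ]} { -[1+ _ ] } _         _         refl = refl
∣∣-injective {x = + _}      { -[1+ _ ] } (j<a , _) b<j       refl = contradiction (ℕ.≤-pred j<a) (ℕ.<⇒≱ b<j)
∣∣-injective {x = -[1+ _ ]} { + _ }      a<j       (j<b , _) refl = contradiction (ℕ.≤-pred j<b) (ℕ.<⇒≱ a<j)

unique-∣∣ : ∀ {n j σ} → All (Admissible n j) σ → Unique σ → Unique (map ∣_∣ σ)
unique-∣∣ []        []         = []
unique-∣∣ (ax ∷ aσ) (x∉σ ∷ σ!) =
  All.map⁺ (All.zipWith (λ (ay , x≢y) → x≢y ∘ ∣∣-injective ax ay) (aσ , x∉σ)) ∷ unique-∣∣ aσ σ!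

BCond⇔ : ∀ {n k j σ} → j ≤ n → length σ ≡ n →
         BCond n k j σ ⇔ (All (Admissible n j) σ × Arrℤ.Arrangement 0ℤ (+ k) σ)
BCond⇔ {σ = σ} j≤n |σ|≡n = mk⇔
  (λ { ((_ , ∣σ∣! , ∣σ∣⊆) , d≡k , signs) →
         All.map (Equivalence.to (letter⇔ _)) (All.zip (All.map⁻ ∣σ∣⊆ , signs)) ,
         Unique.map⁻ ∣σ∣! ,
         cong +_ (trans (descents≡descℤ (0ℤ ∷ σ)) d≡k) })
  (λ { (aσ , σ! , d≡k) →
         let ∣σ∣⊆ , signs = All.unzip (All.map (Equivalence.from (letter⇔ _)) aσ) in
         (|σ|≡n , unique-∣∣ aσ σ! , All.map⁺ ∣σ∣⊆) ,
         trans (sym (descents≡descℤ (0ℤ ∷ σ))) (ℤ.+-injective d≡k) ,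
         signs })
  where
  letter⇔ = SignedLetter⇔Admissible j≤n

applyUpTo-⊖ : ∀ n → applyUpTo (_⊖ n) n ≡ applyDownFrom -[1+_] n
applyUpTo-⊖ zero    = refl
applyUpTo-⊖ (suc n) = cong (-[1+ n ] ∷_) (trans (applyUpTo-cong n (λ i → ℤ.[1+m]⊖[1+n]≡m⊖n i n)) (applyUpTo-⊖ n))

symRange-split : ∀ n → symRange n ≡ applyDownFrom -[1+_] n ++ applyUpTo +_ (suc n)
symRange-split n = begin
  map (λ i → + i - + n) (upTo (suc (n + n)))
    ≡⟨ map-cong (λ i → ℤ.m-n≡m⊖n i n) (upTo (suc (n + n))) ⟩
  map (_⊖ n) (upTo (suc (n + n)))
    ≡⟨ map-upTo (_⊖ n) (suc (n + n)) ⟩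
  applyUpTo (_⊖ n) (suc (n + n))
    ≡⟨ cong (applyUpTo (_⊖ n)) (ℕ.+-suc n n) ⟨
  applyUpTo (_⊖ n) (n + suc n)
    ≡⟨ applyUpTo-++ (_⊖ n) n (suc n) ⟩
  applyUpTo (_⊖ n) n ++ applyUpTo (λ i → (n + i) ⊖ n) (suc n)
    ≡⟨ cong₂ _++_ (applyUpTo-⊖ n) (applyUpTo-cong (suc n) n+i⊖n≡i) ⟩
  applyDownFrom -[1+_] n ++ applyUpTo +_ (suc n)
    ∎
  where
  open ≡-Reasoning
  n+i⊖n≡i : ∀ i → (n + i) ⊖ n ≡ + i
  n+i⊖n≡i i = trans (ℤ.⊖-≥ (ℕ.m≤m+n n i)) (cong +_ (ℕ.m+n∸m≡n n i))

symRange-increasing : ∀ n → AllPairs ℤ._<_ (symRange n)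
symRange-increasing n =
  AllPairs.map⁺ (AllPairs.applyUpTo⁺₁ id (suc (n + n)) (λ i<j _ → ℤ.+-monoˡ-< (ℤ.- + n) (ℤ.+<+ i<j)))

count-admissible-negatives : ∀ N j n → count (admissible? N j) (applyDownFrom -[1+_] n) ≡ n ⊓ j
count-admissible-negatives N j zero    = refl
count-admissible-negatives N j (suc n) with n ℕ.<? j
... | yes n<j = trans (cong length (filter-accept (admissible? N j) n<j))
                  (trans (cong suc (trans (count-admissible-negatives N j n) (ℕ.m≤n⇒m⊓n≡m (ℕ.<⇒≤ n<j))))
                         (sym (ℕ.m≤n⇒m⊓n≡m n<j)))
... | no  n≮j = trans (cong length (filter-reject (admissible? N j) n≮j))
                  (trans (count-admissible-negatives N j n)
                    (trans (ℕ.m≥n⇒m⊓n≡n j≤n) (sym (ℕ.m≥n⇒m⊓n≡n (ℕ.m≤n⇒m≤1+n j≤n)))))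
  where j≤n = ℕ.≮⇒≥ n≮j

count-admissible-positives : ∀ {n j} m → m ≤ suc n → count (admissible? n j) (applyUpTo +_ m) ≡ m ∸ suc j
count-admissible-positives zero    _ = refl
count-admissible-positives {n} {j} (suc m) (s≤s m≤n) = begin
  count (admissible? n j) (applyUpTo +_ (suc m))
    ≡⟨ cong (count (admissible? n j)) (applyUpTo-∷ʳ +_ m) ⟨
  count (admissible? n j) (applyUpTo +_ m ++ + m ∷ [])
    ≡⟨ count-++ (admissible? n j) (applyUpTo +_ m) (+ m ∷ []) ⟩
  count (admissible? n j) (applyUpTo +_ m) + count (admissible? n j) (+ m ∷ [])
    ≡⟨ cong (_+ count (admissible? n j) (+ m ∷ [])) (count-admissible-positives m (ℕ.m≤n⇒m≤1+n m≤n)) ⟩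
  m ∸ suc j + count (admissible? n j) (+ m ∷ [])
    ≡⟨ last-letter ⟩
  m ∸ j
    ∎
  where
  open ≡-Reasoning
  last-letter : m ∸ suc j + count (admissible? n j) (+ m ∷ []) ≡ m ∸ j
  last-letter with j ℕ.<? m
  ... | yes j<m = begin
    m ∸ suc j + count (admissible? n j) (+ m ∷ [])
      ≡⟨ cong (λ c → m ∸ suc j + length c) (filter-accept (admissible? n j) (j<m , m≤n)) ⟩
    m ∸ suc j + 1      ≡⟨ ℕ.+-comm (m ∸ suc j) 1 ⟩
    suc (m ∸ suc j)    ≡⟨ ℕ.+-∸-assoc 1 j<m ⟨
    m ∸ j              ∎
  ... | no  j≮m = begin
    m ∸ suc j + count (admissible? n j) (+ m ∷ [])
      ≡⟨ cong (λ c → m ∸ suc j + length c) (filter-reject (admissible? n j) (j≮m ∘ proj₁)) ⟩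
    m ∸ suc j + 0      ≡⟨ ℕ.+-identityʳ (m ∸ suc j) ⟩
    m ∸ suc j          ≡⟨ ℕ.m≤n⇒m∸n≡0 (ℕ.m≤n⇒m≤1+n (ℕ.≮⇒≥ j≮m)) ⟩
    0                  ≡⟨ ℕ.m≤n⇒m∸n≡0 (ℕ.≮⇒≥ j≮m) ⟨
    m ∸ j              ∎

module _ {n j : ℕ} (j≤n : j ≤ n) where

  private
    Neg = applyDownFrom -[1+_] n
    Pos = applyUpTo +_ (suc n)
    adm? = admissible? n j

  count-admissible : count adm? (symRange n) ≡ n
  count-admissible = begin
    count adm? (symRange n)          ≡⟨ cong (count adm?) (symRange-split n) ⟩
    count adm? (Neg ++ Pos)          ≡⟨ count-++ adm? Neg Pos ⟩
    count adm? Neg + count adm? Pos  ≡⟨ cong₂ _+_ (count-admissible-negatives n j n)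
                                                  (count-admissible-positives (suc n) ℕ.≤-refl) ⟩
    n ⊓ j + (n ∸ j)                  ≡⟨ cong (_+ (n ∸ j)) (ℕ.m≥n⇒m⊓n≡n j≤n) ⟩
    j + (n ∸ j)                      ≡⟨ ℕ.m+[n∸m]≡n j≤n ⟩
    n                                ∎
    where open ≡-Reasoning

  rank-admissible : Arrℤ.rank (filter adm? (symRange n)) 0ℤ ≡ j
  rank-admissible = begin
    count (Arrℤ._<? 0ℤ) (filter adm? (symRange n))
      ≡⟨ cong (count (Arrℤ._<? 0ℤ) ∘ filter adm?) (symRange-split n) ⟩
    count (Arrℤ._<? 0ℤ) (filter adm? (Neg ++ Pos))
      ≡⟨ cong (count (Arrℤ._<? 0ℤ)) (filter-++ adm? Neg Pos) ⟩
    count (Arrℤ._<? 0ℤ) (filter adm? Neg ++ filter adm? Pos)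
      ≡⟨ count-++ (Arrℤ._<? 0ℤ) (filter adm? Neg) (filter adm? Pos) ⟩
    count (Arrℤ._<? 0ℤ) (filter adm? Neg) + count (Arrℤ._<? 0ℤ) (filter adm? Pos)
      ≡⟨ cong₂ _+_ (cong length (filter-all (Arrℤ._<? 0ℤ) (All.filter⁺ adm? Neg<0)))
                   (count-none (Arrℤ._<? 0ℤ) (All.filter⁺ adm? Pos≮0)) ⟩
    count adm? Neg + 0
      ≡⟨ ℕ.+-identityʳ _ ⟩
    count adm? Neg
      ≡⟨ count-admissible-negatives n j n ⟩
    n ⊓ j
      ≡⟨ ℕ.m≥n⇒m⊓n≡n j≤n ⟩
    j ∎
    where
    open ≡-Reasoning
    Neg<0 : All (ℤ._< 0ℤ) Neg
    Neg<0 = All.applyDownFrom⁺₁ -[1+_] n (λ _ → ℤ.-<+)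
    Pos≮0 : All (λ x → ¬ x ℤ.< 0ℤ) Pos
    Pos≮0 = All.applyUpTo⁺₂ +_ (suc n) (λ _ → ℤ.+≮0)

  bCount≡E : ∀ k → bCount n k j ≡ E n j (+ k)
  bCount≡E k = begin
    count (bcond? n k j) (words n (symRange n))
      ≡⟨ count-cong-∈ (bcond? n k j) (all? adm? ∩? arrangement?) (words n (symRange n))
                      (BCond⇔ j≤n ∘ All.lookup (words-length n (symRange n))) ⟩
    count (all? adm? ∩? arrangement?) (words n (symRange n))
      ≡⟨ count-words-filter adm? arrangement? n (symRange n) ⟩
    count arrangement? (words n (filter adm? (symRange n)))
      ≡⟨ Arrℤ.count-arrangements n _ count-admissible (AllPairs.filter⁺ adm? (symRange-increasing n)) 0ℤ (+ k) ⟩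
    E n (Arrℤ.rank (filter adm? (symRange n)) 0ℤ) (+ k)
      ≡⟨ cong (λ r → E n r (+ k)) rank-admissible ⟩
    E n j (+ k)
      ∎
    where
    open ≡-Reasoning
    arrangement? = Arrℤ.arrangement? 0ℤ (+ k)

b≡E : ∀ {n j} → j ≤ n → ∀ k → b n k (+ j) ≡ E n j k
b≡E {n} {j} j≤n (+ k) with k ℕ.≤? n | j ℕ.≤? n
... | yes _   | yes _   = bCount≡E j≤n k
... | yes _   | no  j≰n = contradiction j≤n j≰n
... | no  k≰n | _       = sym (E-above j≤n (ℕ.≰⇒> k≰n))
b≡E {n} {j} j≤n -[1+ k ] = sym (E-negative n j k)

+-injective-combination : ∀ a y b z {x} → + x ≡ + a ℤ.* + y ℤ.+ + b ℤ.* + z → x ≡ a * y + b * z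
+-injective-combination a y b z eq =
  ℤ.+-injective (trans eq (sym (trans (ℤ.pos-+ (a * y) (b * z)) (cong₂ ℤ._+_ (ℤ.pos-* a y) (ℤ.pos-* b z)))))

m-n≡m∸n : ∀ {m n} → n ≤ m → + m - + n ≡ + (m ∸ n)
m-n≡m∸n {m} {n} n≤m = trans (ℤ.m-n≡m⊖n m n) (ℤ.⊖-≥ n≤m)

E-rec₁ℕ : ∀ {m j k} → j ≤ m → k ≤ suc m →
          E (suc m) j (+ k) ≡ (k + 1) * E m j (+ k) + (suc m ∸ k) * E m j (+ k - 1ℤ)
E-rec₁ℕ {m} {j} {k} j≤m k≤1+m = +-injective-combination (k + 1) _ (suc m ∸ k) _ (trans (E-rec₁ m j j≤m (+ k))
  (cong₂ (λ a b → a ℤ.* Eᶻ m j (+ k) ℤ.+ b ℤ.* Eᶻ m j (+ k - 1ℤ)) (sym (ℤ.pos-+ k 1)) (m-n≡m∸n k≤1+m)))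

E-rec₂ℕ : ∀ {m j k} → j ≤ m → k ≤ suc m →
          E (suc m) (suc j) (+ k) ≡ k * E m j (+ k) + (suc m ∸ k + 1) * E m j (+ k - 1ℤ)
E-rec₂ℕ {m} {j} {k} j≤m k≤1+m = +-injective-combination k _ (suc m ∸ k + 1) _ (trans (E-rec₂ m j j≤m (+ k))
  (cong (λ b → + k ℤ.* Eᶻ m j (+ k) ℤ.+ b ℤ.* Eᶻ m j (+ k - 1ℤ))
        (trans (cong (ℤ._+ 1ℤ) (m-n≡m∸n k≤1+m)) (sym (ℤ.pos-+ (suc m ∸ k) 1)))))

b-column-0 : ∀ n k → b n (+ k) (+ 0) ≡ A n k
b-column-0 n k = trans (b≡E {n} z≤n (+ k)) (sym (A≡E n k))

b-row-0 : ∀ {n j} → j ≤ n → b n (+ 0) (+ j) ≡ [ j ≡ᵇ 0 ]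
b-row-0 {n} {j} j≤n = trans (b≡E j≤n (+ 0)) (E-no-descent n j j≤n)

b-row-n : ∀ {n j} → j ≤ n → b n (+ n) (+ j) ≡ [ j ≡ᵇ n ]
b-row-n {n} {j} j≤n = trans (b≡E j≤n (+ n)) (E-all-descents n j j≤n)

b-sym : ∀ {n k j} → k ≤ n → j ≤ n → b n (+ k) (+ j) ≡ b n (+ (n ∸ k)) (+ (n ∸ j))
b-sym {n} {k} {j} k≤n j≤n = begin
  b n (+ k) (+ j)              ≡⟨ b≡E j≤n (+ k) ⟩
  E n j (+ k)                  ≡⟨ E-sym n j j≤n (+ k) ⟩
  E n (n ∸ j) (+ n - + k)      ≡⟨ cong (E n (n ∸ j)) (m-n≡m∸n k≤n) ⟩
  E n (n ∸ j) (+ (n ∸ k))      ≡⟨ b≡E (ℕ.m∸n≤m n j) (+ (n ∸ k)) ⟨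
  b n (+ (n ∸ k)) (+ (n ∸ j))  ∎
  where open ≡-Reasoning

b-column-n : ∀ {n k} → k ≤ n → b n (+ k) (+ n) ≡ A n (n ∸ k)
b-column-n {n} {k} k≤n = begin
  b n (+ k) (+ n)              ≡⟨ b-sym k≤n ℕ.≤-refl ⟩
  b n (+ (n ∸ k)) (+ (n ∸ n))  ≡⟨ cong (λ j → b n (+ (n ∸ k)) (+ j)) (ℕ.n∸n≡0 n) ⟩
  b n (+ (n ∸ k)) (+ 0)        ≡⟨ b-column-0 n (n ∸ k) ⟩
  A n (n ∸ k)                  ∎
  where open ≡-Reasoning

b-rec₁ : ∀ {m k j} → k ≤ suc m → j < suc m →
         b (suc m) (+ k) (+ j) ≡ (k + 1) * b m (+ k) (+ j) + (suc m ∸ k) * b m (+ k - 1ℤ) (+ j)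
b-rec₁ {m} {k} {j} k≤1+m (s≤s j≤m) = begin
  b (suc m) (+ k) (+ j)                                           ≡⟨ b≡E (ℕ.m≤n⇒m≤1+n j≤m) (+ k) ⟩
  E (suc m) j (+ k)                                               ≡⟨ E-rec₁ℕ j≤m k≤1+m ⟩
  (k + 1) * E m j (+ k) + (suc m ∸ k) * E m j (+ k - 1ℤ)          ≡⟨ cong₂ (λ x y → (k + 1) * x + (suc m ∸ k) * y)
                                                                           (b≡E j≤m (+ k)) (b≡E j≤m (+ k - 1ℤ)) ⟨
  (k + 1) * b m (+ k) (+ j) + (suc m ∸ k) * b m (+ k - 1ℤ) (+ j)  ∎
  where open ≡-Reasoning

b-rec₂ : ∀ {m k j} → k ≤ suc m → 0 < j → j ≤ suc m →
         b (suc m) (+ k) (+ j) ≡ k * b m (+ k) (+ j - 1ℤ) + (suc m ∸ k + 1) * b m (+ k - 1ℤ) (+ j - 1ℤ)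
b-rec₂ {m} {k} {suc j} k≤1+m _ (s≤s j≤m) = begin
  b (suc m) (+ k) (+ suc j)                                       ≡⟨ b≡E {suc m} (s≤s j≤m) (+ k) ⟩
  E (suc m) (suc j) (+ k)                                         ≡⟨ E-rec₂ℕ j≤m k≤1+m ⟩
  k * E m j (+ k) + (suc m ∸ k + 1) * E m j (+ k - 1ℤ)            ≡⟨ cong₂ (λ x y → k * x + (suc m ∸ k + 1) * y)
                                                                           (b≡E j≤m (+ k)) (b≡E j≤m (+ k - 1ℤ)) ⟨
  k * b m (+ k) (+ j) + (suc m ∸ k + 1) * b m (+ k - 1ℤ) (+ j)    ∎
  where open ≡-Reasoning

proposition5p1 :
    ((n k j : ℕ) → k ≤ n → j ≤ n →
        (b n (+ 0) (+ j) ≡ [ j ≡ᵇ 0 ])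
      × (b n (+ n) (+ j) ≡ [ j ≡ᵇ n ])
      × (b n (+ k) (+ 0) ≡ A n k)
      × (b n (+ k) (+ n) ≡ A n (n ∸ k))
      × (b n (+ k) (+ j) ≡ b n (+ (n ∸ k)) (+ (n ∸ j))))
    × ((m k j : ℕ) → k ≤ suc m →
        (j < suc m →
          b (suc m) (+ k) (+ j)
            ≡ (k + 1) * b m (+ k) (+ j) + (suc m ∸ k) * b m (+ k - 1ℤ) (+ j))
      × (0 < j → j ≤ suc m →
          b (suc m) (+ k) (+ j)
            ≡ k * b m (+ k) (+ j - 1ℤ) + (suc m ∸ k + 1) * b m (+ k - 1ℤ) (+ j - 1ℤ)))
proposition5p1 =
    (λ n k j k≤n j≤n → b-row-0 j≤n , b-row-n j≤n , b-column-0 n k , b-column-n k≤n , b-sym k≤n j≤n)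
  , (λ m k j k≤1+m → b-rec₁ k≤1+m , b-rec₂ k≤1+m)
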